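{- $\mathfrak{b}\le\mathfrak{S}'$.
   Context: A partition of $\omega$ is a set of pairwise disjoint nonempty subsets of $\omega$ (blocks) with union $\omega$. $(\omega)^\omega$ is the set of partitions with infinitely many blocks, $(\omega)^\omega_\infty$ the set of those $X\in(\omega)^\omega$ with at least one infinite block. $X\sqsubseteq Y$ ($X$ coarser than $Y$) means every block of $X$ is a union of blocks of $Y$; $X\sqcup Y$ is the finest partition coarser than both $X$ and $Y$. For finite $f\subseteq\omega$, $X\sqcup\{f\}$ is the finest partition coarser than $X$ having $f$ inside one block; $X\sqsubseteq^*Y$ iff $X\sqcup\{f\}\sqsubseteq Y$ for some finite $f$; $X\approx Y$ iff $X\sqsubseteq^*Y$ and $Y\sqsubseteq^*X$. $X$ is trivial if $X\approx$ the partition of $\omega$ into singletons. $X_1,X_2\in(\omega)^\omega$ are compatible if $X_1\sqcup X_2\in(\omega)^\omega$, and orthogonal ($X_1\perp X_2$) if $X_1\sqcup X_2$ has exactly one block $\omega$. $X_1$ splits $X_2$ if $X_1$ is compatible with $X_2$ and there is $Y\in(\omega)^\omega$ with $Y\sqsubseteq X_2$ and $X_1\perp Y$. A family $\mathcal{S}$ is splitting if every non-trivial $X\in(\omega)^\omega$ is split by some $S\in\mathcal{S}$. $\mathfrak{S}'$ is the least cardinality of a splitting family $\mathcal{S}\subseteq(\omega)^\omega_\infty$. $\mathfrak{b}$ is the bounding number. -}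

module Defs where

open import Level using (0ℓ)
open import Data.Nat using (ℕ; _≤_)
open import Data.List using (List)
open import Data.List.Membership.Propositional using (_∈_)
open import Data.List.Relation.Unary.All using (All)
open import Data.Product using (Σ; ∃; _×_)
open import Data.Empty using (⊥)
open import Relation.Nullary using (¬_)
open import Relation.Binary using (Rel; IsEquivalence)
open import Relation.Binary.PropositionalEquality using (_≡_)

record Partition : Set₁ where
  field
    _~_   : Rel ℕ 0ℓ
    isEqv : IsEquivalence _~_
open Partition public

discrete : Partition
discrete = record { _~_ = _≡_ ; isEqv = Relation.Binary.PropositionalEquality.isEquivalence }
  where import Relation.Binary.PropositionalEquality

InfManyBlocks : Partition → Set
InfManyBlocks X = (xs : List ℕ) → ∃ λ m → All (λ x → ¬ (_~_ X m x)) xs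

-- X ∈ (ω)^ω_∞ requires additionally an infinite block: the block of some a
-- contains elements above every n.
HasInfiniteBlock : Partition → Set
HasInfiniteBlock X = ∃ λ a → (n : ℕ) → ∃ λ m → n ≤ m × _~_ X a m

_⊑_ : Partition → Partition → Set
X ⊑ Y = (a b : ℕ) → _~_ Y a b → _~_ X a b

data Join (R S : Rel ℕ 0ℓ) : Rel ℕ 0ℓ where
  j-refl  : ∀ {a} → Join R S a a
  j-left  : ∀ {a b} → R a b → Join R S a b
  j-right : ∀ {a b} → S a b → Join R S a b
  j-sym   : ∀ {a b} → Join R S a b → Join R S b a
  j-trans : ∀ {a b c} → Join R S a b → Join R S b c → Join R S a c

joinIsEqv : (R S : Rel ℕ 0ℓ) → IsEquivalence (Join R S)
joinIsEqv R S = record { refl = j-refl ; sym = j-sym ; trans = j-trans }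

_⊔_ : Partition → Partition → Partition
X ⊔ Y = record { _~_ = Join (_~_ X) (_~_ Y) ; isEqv = joinIsEqv (_~_ X) (_~_ Y) }

inFin : List ℕ → Rel ℕ 0ℓ
inFin f a b = a ∈ f × b ∈ f

_⊔fin_ : Partition → List ℕ → Partition
X ⊔fin f = record { _~_ = Join (_~_ X) (inFin f) ; isEqv = joinIsEqv (_~_ X) (inFin f) }

_⊑*_ : Partition → Partition → Set
X ⊑* Y = Σ (List ℕ) λ f → (X ⊔fin f) ⊑ Y

_≈ₚ_ : Partition → Partition → Set
X ≈ₚ Y = (X ⊑* Y) × (Y ⊑* X)

Trivial : Partition → Set
Trivial X = X ≈ₚ discrete

Compatible : Partition → Partition → Set
Compatible X₁ X₂ = InfManyBlocks (X₁ ⊔ X₂)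

Orthogonal : Partition → Partition → Set
Orthogonal X₁ X₂ = (a b : ℕ) → _~_ (X₁ ⊔ X₂) a b

Splits : Partition → Partition → Set₁
Splits X₁ X₂ = Compatible X₁ X₂ ×
  Σ Partition λ Y → InfManyBlocks Y × (Y ⊑ X₂) × Orthogonal X₁ Y

Splitting : {I : Set} → (I → Partition) → Set₁
Splitting {I} S = (X : Partition) → InfManyBlocks X → ¬ Trivial X →
  ∃ λ (i : I) → Splits (S i) X

_≤*_ : (ℕ → ℕ) → (ℕ → ℕ) → Set
g ≤* f = ∃ λ N → (n : ℕ) → N ≤ n → g n ≤ f n

Bounded : {I : Set} → (I → ℕ → ℕ) → Set
Bounded {I} g = ∃ λ (f : ℕ → ℕ) → (i : I) → g i ≤* f

-- Let f bound the functions picking, above each n, a point of the infinite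
-- block of S i. Cut ω into intervals [F k, F (k + 1)) long enough that each
-- contains f (F k) and has at least two points; this interval partition X is
-- non-trivial with infinitely many blocks. For every i the infinite block of
-- S i meets all but finitely many intervals, so S i ⊔ X has finitely many
-- blocks: S i is not even compatible with X.
module Submission where

open import Defs
open import Data.List using (List; _∷_; upTo)
open import Data.List.Extrema.Nat using (argmax; f[xs]≤f[argmax]; max; xs≤max)
open import Data.List.Membership.Propositional using (_∉_)
open import Data.List.Membership.Propositional.Properties using (∈-upTo⁺)
open import Data.List.Relation.Unary.All as All using (All)
open import Data.List.Relation.Unary.All.Properties using (All¬⇒¬Any)
open import Data.List.Relation.Unary.Any as Any using (Any; here; there)
open import Data.Nat using (ℕ; zero; suc; _+_; _≤_; _<_; z≤n; s≤s; _≤?_; _<?_)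
open import Data.Nat.Properties
open import Data.Product using (∃; ∃₂; _×_; _,_; proj₁; proj₂)
open import Data.Sum using (_⊎_; inj₁; inj₂; [_,_])
open import Data.Empty using (⊥; ⊥-elim)
open import Function using (_∘_)
open import Relation.Nullary using (¬_; yes; no)
open import Relation.Binary using (tri<; tri≈; tri>)
open import Relation.Binary.PropositionalEquality using (_≡_; _≢_; refl; sym; trans; subst)

kernel : (ℕ → ℕ) → Partition
kernel c = record
  { _~_   = λ a b → c a ≡ c b
  ; isEqv = record { refl = refl ; sym = sym ; trans = trans }
  }

kernel-infManyBlocks : (c : ℕ → ℕ) → (∀ k → ∃ λ n → c n ≡ k) → InfManyBlocks (kernel c)
kernel-infManyBlocks c c-onto xs with c-onto (suc (c (argmax c 0 xs)))
... | n , c[n]≡1+B = n , All.map c[n]≢ (f[xs]≤f[argmax] 0 xs)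
  where
  B : ℕ
  B = c (argmax c 0 xs)
  c[n]≢ : ∀ {x} → c x ≤ B → c n ≢ c x
  c[n]≢ c[x]≤B c[n]≡c[x] = 1+n≰n (subst (_≤ B) (trans (sym c[n]≡c[x]) c[n]≡1+B) c[x]≤B)

coveredBy⇒¬InfManyBlocks : (Z : Partition) (xs : List ℕ) →
  (∀ m → Any (_~_ Z m) xs) → ¬ InfManyBlocks Z
coveredBy⇒¬InfManyBlocks Z xs covered infinite =
  All¬⇒¬Any (proj₂ (infinite xs)) (covered (proj₁ (infinite xs)))

discrete⊔fin⇒≡∨inFin : ∀ fl {a b} → _~_ (discrete ⊔fin fl) a b → a ≡ b ⊎ inFin fl a b
discrete⊔fin⇒≡∨inFin fl j-refl           = inj₁ refl
discrete⊔fin⇒≡∨inFin fl (j-left a≡b)     = inj₁ a≡b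
discrete⊔fin⇒≡∨inFin fl (j-right a,b∈fl) = inj₂ a,b∈fl
discrete⊔fin⇒≡∨inFin fl (j-sym b~a) with discrete⊔fin⇒≡∨inFin fl b~a
... | inj₁ b≡a           = inj₁ (sym b≡a)
... | inj₂ (b∈fl , a∈fl) = inj₂ (a∈fl , b∈fl)
discrete⊔fin⇒≡∨inFin fl (j-trans a~b b~c)
  with discrete⊔fin⇒≡∨inFin fl a~b | discrete⊔fin⇒≡∨inFin fl b~c
... | inj₁ refl       | b~c′            = b~c′
... | inj₂ a,b∈fl     | inj₁ refl       = inj₂ a,b∈fl
... | inj₂ (a∈fl , _) | inj₂ (_ , c∈fl) = inj₂ (a∈fl , c∈fl)

distinctPairs⇒¬Trivial : (X : Partition) →
  (∀ fl → ∃₂ λ a b → a ≢ b × a ∉ fl × _~_ X a b) → ¬ Trivial X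
distinctPairs⇒¬Trivial X pairs (_ , fl , discrete⊔fl⊑X) with pairs fl
... | a , b , a≢b , a∉fl , a~b =
  [ a≢b , a∉fl ∘ proj₁ ] (discrete⊔fin⇒≡∨inFin fl (discrete⊔fl⊑X a b a~b))

module Intervals (F : ℕ → ℕ) (F-zero : F 0 ≡ 0) (F-step : ∀ k → F k < F (suc k)) where

  F-mono-< : ∀ {m n} → m < n → F m < F n
  F-mono-< {m} {suc n} m<1+n with m<1+n⇒m<n∨m≡n m<1+n
  ... | inj₁ m<n  = <-trans (F-mono-< m<n) (F-step n)
  ... | inj₂ refl = F-step m

  F-mono-≤ : ∀ {m n} → m ≤ n → F m ≤ F n
  F-mono-≤ m≤n with m≤n⇒m<n∨m≡n m≤n
  ... | inj₁ m<n  = <⇒≤ (F-mono-< m<n)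
  ... | inj₂ refl = ≤-refl

  n≤F[n] : ∀ n → n ≤ F n
  n≤F[n] zero    = z≤n
  n≤F[n] (suc n) = ≤-<-trans (n≤F[n] n) (F-step n)

  index : ℕ → ℕ
  index zero = 0
  index (suc n) with F (suc (index n)) ≤? suc n
  ... | yes _ = suc (index n)
  ... | no  _ = index n

  index-bounds : ∀ n → F (index n) ≤ n × n < F (suc (index n))
  index-bounds zero = ≤-reflexive F-zero , subst (_< F 1) F-zero (F-step 0)
  index-bounds (suc n) with F (suc (index n)) ≤? suc n
  ... | yes F≤1+n = F≤1+n , ≤-<-trans (proj₂ (index-bounds n)) (F-step _)
  ... | no  F≰1+n = m≤n⇒m≤1+n (proj₁ (index-bounds n)) , ≰⇒> F≰1+n

  index-unique : ∀ {n k} → F k ≤ n → n < F (suc k) → index n ≡ k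
  index-unique {n} {k} F[k]≤n n<F[1+k] with <-cmp (index n) k
  ... | tri< i<k _ _ = ⊥-elim (<⇒≱ (proj₂ (index-bounds n)) (≤-trans (F-mono-≤ i<k) F[k]≤n))
  ... | tri≈ _ i≡k _ = i≡k
  ... | tri> _ _ k<i = ⊥-elim (<⇒≱ n<F[1+k] (≤-trans (F-mono-≤ k<i) (proj₁ (index-bounds n))))

  index-F : ∀ k → index (F k) ≡ k
  index-F k = index-unique ≤-refl (F-step k)

  F≤⇒≤index : ∀ {N n} → F N ≤ n → N ≤ index n
  F≤⇒≤index {N} {n} F[N]≤n =
    ≮⇒≥ λ i<N → <⇒≱ (proj₂ (index-bounds n)) (≤-trans (F-mono-≤ i<N) F[N]≤n)

  intervals : Partition
  intervals = kernel index

  intervals-infManyBlocks : InfManyBlocks intervals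
  intervals-infManyBlocks = kernel-infManyBlocks index λ k → F k , index-F k

  intervals-nonTrivial : (∀ k → suc (F k) < F (suc k)) → ¬ Trivial intervals
  intervals-nonTrivial wide = distinctPairs⇒¬Trivial intervals pair
    where
    pair : ∀ fl → ∃₂ λ a b → a ≢ b × a ∉ fl × index a ≡ index b
    pair fl = F k , suc (F k) , <⇒≢ (n<1+n (F k)) , F[k]∉fl
            , trans (index-F k) (sym (index-unique (n≤1+n (F k)) (wide k)))
      where
      k : ℕ
      k = suc (max 0 fl)
      F[k]∉fl : F k ∉ fl
      F[k]∉fl F[k]∈fl = <⇒≱ (n≤F[n] k) (All.lookup (xs≤max 0 fl) F[k]∈fl)

  meetsEventually⇒¬Compatible : (Y : Partition) (a N : ℕ) →
    (∀ k → N ≤ k → ∃ λ b → index b ≡ k × _~_ Y a b) → ¬ Compatible Y intervals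
  meetsEventually⇒¬Compatible Y a N meets =
    coveredBy⇒¬InfManyBlocks (Y ⊔ intervals) (a ∷ upTo (F N)) covered
    where
    covered : ∀ m → Any (_~_ (Y ⊔ intervals) m) (a ∷ upTo (F N))
    covered m with m <? F N
    ... | yes m<F[N] = there (Any.map (λ { refl → j-refl }) (∈-upTo⁺ m<F[N]))
    ... | no  m≮F[N] with meets (index m) (F≤⇒≤index (≮⇒≥ m≮F[N]))
    ...   | b , index[b]≡index[m] , a~b =
      here (j-trans (j-right (sym index[b]≡index[m])) (j-sym (j-left a~b)))

nextInBlock : (Y : Partition) → HasInfiniteBlock Y → ℕ → ℕ
nextInBlock _ (_ , above) n = proj₁ (above n)

module DominatingIntervals (f : ℕ → ℕ) where

  F : ℕ → ℕ
  F zero    = 0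
  F (suc k) = 2 + (F k + f (F k))

  F-wide : ∀ k → suc (F k) < F (suc k)
  F-wide k = s≤s (s≤s (m≤m+n (F k) (f (F k))))

  f[F[k]]<F[1+k] : ∀ k → f (F k) < F (suc k)
  f[F[k]]<F[1+k] k = s≤s (m≤n⇒m≤1+n (m≤n+m (f (F k)) (F k)))

  open Intervals F refl (λ k → <-trans (n<1+n (F k)) (F-wide k)) public

  infiniteBlock⇒¬Compatible : (Y : Partition) (infinite : HasInfiniteBlock Y) →
    nextInBlock Y infinite ≤* f → ¬ Compatible Y intervals
  infiniteBlock⇒¬Compatible Y (a , above) (N , dominated) =
    meetsEventually⇒¬Compatible Y a N meets
    where
    meets : ∀ k → N ≤ k → ∃ λ b → index b ≡ k × _~_ Y a b
    meets k N≤k = b , index-unique F[k]≤b b<F[1+k] , proj₂ (proj₂ (above (F k)))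
      where
      b : ℕ
      b = proj₁ (above (F k))
      F[k]≤b : F k ≤ b
      F[k]≤b = proj₁ (proj₂ (above (F k)))
      b<F[1+k] : b < F (suc k)
      b<F[1+k] = ≤-<-trans (dominated (F k) (≤-trans N≤k (n≤F[n] k))) (f[F[k]]<F[1+k] k)

mainTheorem7 : (I : Set) (S : I → Partition) →
    ((i : I) → InfManyBlocks (S i) × HasInfiniteBlock (S i)) →
    ((g : I → ℕ → ℕ) → Bounded g) →
    Splitting S → ⊥
mainTheorem7 I S S∈ω∞ bounded splitting =
  let (f , dominates) = bounded λ i → nextInBlock (S i) (proj₂ (S∈ω∞ i))
      open DominatingIntervals f
      (i , compatible , _) = splitting intervals intervals-infManyBlocks (intervals-nonTrivial F-wide)
  in infiniteBlock⇒¬Compatible (S i) (proj₂ (S∈ω∞ i)) (dominates i) compatible
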